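{- There does not exist a function $f\colon\mathbb{N}\to\mathbb{N}$ such that for every laminar matroid $M$ on a ground set $E=\{e_1,\ldots,e_n\}$, every total order $\preceq$ on $E$ with $e_1\prec\cdots\prec e_n$, and every $i\in\{0,\ldots,n-1\}$, the $i$-th width of the ZDD $\mathsf{Z}(\mathcal{I}(M))$ with respect to $(E,\preceq)$ is at most $f(\lambda_M(\{e_1,\ldots,e_i\}))$.
   Context: A family $\mathcal{A}\subseteq 2^E$ is laminar if $A\subseteq B$ or $B\subseteq A$ whenever $A,B\in\mathcal{A}$ and $A\cap B\neq\emptyset$. $M$ is laminar if there are a laminar family $\mathcal{A}$ and $c\colon\mathcal{A}\to\mathbb{N}$ such that $I\subseteq E$ is independent iff $|I\cap A|\le c(A)$ for all $A\in\mathcal{A}$. $\mathcal{I}(M)$ is the collection of independent sets, $r_M$ the rank function, and $\lambda_M(X)=r_M(X)+r_M(E\setminus X)-r_M(E)$. The ZDD $\mathsf{Z}(\mathcal{S})$ of $\mathcal{S}\subseteq 2^E$ w.r.t. $(E,\preceq)$ is obtained from the complete binary decision tree of $\mathcal{S}$ (internal nodes at depth $j$ labeled $e_{j+1}$, each with a 0-arc to $\nu_0$ and 1-arc to $\nu_1$; the leaf reached by taking 1-arcs exactly at elements of $X$ is the terminal $\top$ iff $X\in\mathcal{S}$, else $\bot$) by exhaustively merging non-terminal nodes with the same label and same 0- and 1-successors, and removing every non-terminal $\nu$ with $\nu_1=\bot$ (redirecting arcs entering $\nu$ to $\nu_0$). The $i$-th width is the number of non-terminal nodes labeled $e_{i+1}$.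 -}

module Defs where

open import Data.Bool using (Bool; true; false; if_then_else_; _∧_; not)
open import Data.Nat using (ℕ; zero; suc; _∸_; _+_; _⊔_; _≤ᵇ_; _<ᵇ_)
import Data.Nat as ℕ
open import Data.Fin using (Fin; toℕ)
open import Data.Fin.Subset using (Subset; _∩_; ∣_∣; ∁; ⊤; Nonempty; _⊆_)
open import Data.Vec using (Vec; []; _∷_; tabulate; zipWith; foldr)
open import Data.List using (List; []; _∷_; map; length; deduplicate; _++_)
import Data.List as L
open import Data.List.Membership.Propositional using () renaming (_∈_ to _∈ˡ_)
open import Data.Product using (_×_; _,_; proj₁; proj₂)
open import Data.Sum using (_⊎_)
open import Relation.Binary.PropositionalEquality using (_≡_; refl; cong; cong₂)
open import Relation.Nullary using (Dec; yes; no)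
open import Relation.Binary.Definitions using (DecidableEquality)

-- Ground set E = {e_1,…,e_n} is identified with Fin n, where e_{k+1}
-- is the element k : Fin n; the total order is e_1 ≺ ⋯ ≺ e_n.
-- Subsets of E are Data.Fin.Subset (characteristic vectors).

record LaminarMatroid (n : ℕ) : Set where
  field
    family  : List (Subset n × ℕ)
    laminar : ∀ {A B} → A ∈ˡ map proj₁ family → B ∈ˡ map proj₁ family →
              Nonempty (A ∩ B) → A ⊆ B ⊎ B ⊆ A

open LaminarMatroid public

allᵇ : {A : Set} → (A → Bool) → List A → Bool
allᵇ p = L.foldr (λ x b → p x ∧ b) true

independent : ∀ {n} → LaminarMatroid n → Subset n → Bool
independent M I = allᵇ (λ p → ∣ I ∩ proj₁ p ∣ ≤ᵇ proj₂ p) (family M)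

_⊆ᵇ_ : ∀ {n} → Subset n → Subset n → Bool
_⊆ᵇ_ {n} X Y = foldr (λ _ → Bool) _∧_ true (zipWith (λ x y → not x Data.Bool.∨ y) X Y)

allSubsets : ∀ n → List (Subset n)
allSubsets zero    = [] ∷ []
allSubsets (suc n) = map (false ∷_) (allSubsets n) ++ map (true ∷_) (allSubsets n)

rank : ∀ {n} → LaminarMatroid n → Subset n → ℕ
rank {n} M X =
  L.foldr (λ I m → if independent M I ∧ (I ⊆ᵇ X) then ∣ I ∣ ⊔ m else m) 0 (allSubsets n)

conn : ∀ {n} → LaminarMatroid n → Subset n → ℕ
conn M X = rank M X + rank M (∁ X) ∸ rank M ⊤

prefix : ∀ {n} → ℕ → Subset n
prefix i = tabulate (λ j → toℕ j <ᵇ i)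

-- A node is a term
-- node j lo hi  (label e_{j+1}, 0-successor lo, 1-successor hi).
-- Merging nodes with the same label and same successors is
-- hash-consing: merged nodes are equal terms.

data DD : Set where
  ⊥D ⊤D : DD
  node  : ℕ → DD → DD → DD

isBot : DD → Bool
isBot ⊥D = true
isBot _  = false

-- The reduced ZDD of a family F of subsets of the remaining m
-- elements e_{j+1},…,e_{j+m}, built bottom-up from the complete
-- binary decision tree: children are reduced first, and a node
-- whose 1-successor is ⊥ is removed (replaced by its 0-successor).
zddFrom : ∀ m → ℕ → (Vec Bool m → Bool) → DD
zddFrom zero    j F = if F [] then ⊤D else ⊥D
zddFrom (suc m) j F =
  let lo = zddFrom m (suc j) (λ v → F (false ∷ v))
      hi = zddFrom m (suc j) (λ v → F (true ∷ v))
  in if isBot hi then lo else node j lo hi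

ZDD : ∀ n → (Subset n → Bool) → DD
ZDD n S = zddFrom n 0 S

ZDD-indep : ∀ {n} → LaminarMatroid n → DD
ZDD-indep {n} M = ZDD n (independent M)

_≟D_ : DecidableEquality DD
⊥D ≟D ⊥D = yes refl
⊥D ≟D ⊤D = no (λ ())
⊥D ≟D node _ _ _ = no (λ ())
⊤D ≟D ⊥D = no (λ ())
⊤D ≟D ⊤D = yes refl
⊤D ≟D node _ _ _ = no (λ ())
node _ _ _ ≟D ⊥D = no (λ ())
node _ _ _ ≟D ⊤D = no (λ ())
node j a b ≟D node k c d with j ℕ.≟ k | a ≟D c | b ≟D d
... | yes refl | yes refl | yes refl = yes refl
... | no ne | _ | _ = no (λ { refl → ne refl })
... | yes _ | no ne | _ = no (λ { refl → ne refl })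
... | yes _ | yes _ | no ne = no (λ { refl → ne refl })

labeledNodes : ℕ → DD → List DD
labeledNodes i ⊥D = []
labeledNodes i ⊤D = []
labeledNodes i (node j lo hi) =
  (if j ℕ.≡ᵇ i then node j lo hi ∷ [] else [])
    ++ labeledNodes i lo ++ labeledNodes i hi

-- i-th width: number of distinct non-terminal nodes labeled e_{i+1}
width : ℕ → DD → ℕ
width i Z = length (deduplicate _≟D_ (labeledNodes i Z))

{-# OPTIONS --safe #-}
-- Let k = 2 + max (f 0, …, f 4) and let M be the laminar matroid on two copies {1, …, k} ⊎ {1′, …, k′}
-- of [k] with capacity 1 on every twin pair {l, l′} and capacity 2 on the whole ground set (U₂,ₖ with
-- every element doubled in parallel). M has rank 2, so λ_M ≤ 4 everywhere. In Z(𝓘(M)), choosing the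
-- single element l ∈ {2, …, k} among the first k leads to a node labelled 1′, since {l, 1′} is
-- independent. A reduced ZDD determines its family, and the family below the l-th of these nodes
-- excludes exactly l′, so the nodes are distinct: the k-th width is at least k − 1 > f (λ_M (prefix k)).
module Submission where

open import Defs
open import Data.Nat using (ℕ; _≤_)
open import Data.Fin using (Fin; toℕ)
open import Data.Product using (Σ)
open import Relation.Nullary using (¬_)

open import Data.Bool using (Bool; true; false; if_then_else_; _∧_; T)
open import Data.Bool.Properties using (T-∧; T-≡)
open import Data.Empty using (⊥-elim)
open import Data.Fin using (zero; suc; fromℕ<) renaming (_≟_ to _≟ᶠ_)
open import Data.Fin.Properties using (injective⇒≤; suc-injective; toℕ-fromℕ<)
open import Data.Fin.Subset using (Subset; _∩_; ∣_∣; ∁; ⊤; ⊥; ⁅_⁆; _∈_; _⊆_; Nonempty)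
open import Data.Fin.Subset.Properties
  using (∉⊥; ∣⊥∣≡0; ⊆⊤; ⊆-refl; Empty-unique; x∈p∩q⁻; x∈⁅y⁆⇒x≡y; ∣⁅x⁆∣≡1; ∣p∩q∣≤∣p∣; ∩-idem; ∩-identityʳ)
open import Data.List using (List; foldr; []; _∷_; map; length; allFin; lookup; deduplicate)
open import Data.List.Membership.Propositional using () renaming (_∈_ to _∈ˡ_)
open import Data.List.Membership.Propositional.Properties
  using (∈-map⁻; ∈-map⁺; ∈-allFin; ∈-++⁺ˡ; ∈-++⁺ʳ; ∈-deduplicate⁺)
open import Data.List.Relation.Binary.Subset.Propositional using () renaming (_⊆_ to _⊆ˡ_)
open import Data.List.Relation.Unary.Any using (here; there)
open import Data.List.Relation.Unary.Any.Properties using (lookup-index)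
open import Data.Nat using (zero; suc; _+_; _<_; z<s; _≡ᵇ_; _≤ᵇ_; _⊔_; _≤′_; ≤′-refl; ≤′-step; z≤n)
open import Data.Nat.Properties
  using (≤-refl; ≤-trans; m<m+n; ≤-reflexive; n≤1+n; 1+n≰n; ⊔-lub; m≤n⊔m; m≤n⇒m≤n⊔o; m∸n≤m; +-mono-≤;
         +-identityʳ; +-suc; ≡⇒≡ᵇ; ≤⇒≤′; ≤ᵇ⇒≤; ≤⇒≤ᵇ; module ≤-Reasoning)
open import Data.Product using (_×_; _,_; proj₁; proj₂; ∃)
open import Data.Sum using (_⊎_; inj₁; inj₂)
open import Data.Unit using (tt) renaming (⊤ to Unit)
open import Data.Vec using (Vec; []; _∷_; _++_)
open import Data.Vec.Properties using (zipWith-++)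
open import Function using (_∘_; id)
open import Function.Bundles using (Equivalence)
open import Function.Definitions using (Injective)
open import Relation.Binary.PropositionalEquality
  using (_≡_; _≢_; refl; sym; trans; cong; cong₂; subst; module ≡-Reasoning)
open import Relation.Nullary using (yes; no)

open Equivalence using (to; from)

reduce : ℕ → DD → DD → DD
reduce j lo hi = if isBot hi then lo else node j lo hi

RootLabel≥ : ℕ → DD → Set
RootLabel≥ j (node l _ _) = j ≤ l
RootLabel≥ j _            = Unit

RootLabel≥-weaken : ∀ {j} d → RootLabel≥ (suc j) d → RootLabel≥ j d
RootLabel≥-weaken ⊥D           _ = tt
RootLabel≥-weaken ⊤D           _ = tt
RootLabel≥-weaken (node _ _ _) h = ≤-trans (n≤1+n _) h

reduce-rootLabel≥ : ∀ {j lo} hi → RootLabel≥ (suc j) lo → RootLabel≥ j (reduce j lo hi)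
reduce-rootLabel≥ {lo = lo} ⊥D h = RootLabel≥-weaken lo h
reduce-rootLabel≥ ⊤D           _ = ≤-refl
reduce-rootLabel≥ (node _ _ _) _ = ≤-refl

zddFrom-rootLabel≥ : ∀ m j (F : Vec Bool m → Bool) → RootLabel≥ j (zddFrom m j F)
zddFrom-rootLabel≥ zero    j F with F []
... | true  = tt
... | false = tt
zddFrom-rootLabel≥ (suc m) j F =
  reduce-rootLabel≥ (zddFrom m (suc j) (F ∘ (true ∷_))) (zddFrom-rootLabel≥ m (suc j) (F ∘ (false ∷_)))

-- A removed node would leave its 0-successor, whose root label is too large to be a node labelled j.
reduce-injective : ∀ {j lo lo′} hi hi′ → RootLabel≥ (suc j) lo → RootLabel≥ (suc j) lo′ →
                   reduce j lo hi ≡ reduce j lo′ hi′ → lo ≡ lo′ × hi ≡ hi′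
reduce-injective ⊥D           ⊥D           _  _  eq   = eq , refl
reduce-injective ⊥D           ⊤D           h  _  refl = ⊥-elim (1+n≰n h)
reduce-injective ⊥D           (node _ _ _) h  _  refl = ⊥-elim (1+n≰n h)
reduce-injective ⊤D           ⊥D           _  h′ refl = ⊥-elim (1+n≰n h′)
reduce-injective (node _ _ _) ⊥D           _  h′ refl = ⊥-elim (1+n≰n h′)
reduce-injective ⊤D           ⊤D           _  _  refl = refl , refl
reduce-injective (node _ _ _) (node _ _ _) _  _  refl = refl , refl
reduce-injective ⊤D           (node _ _ _) _  _  ()
reduce-injective (node _ _ _) ⊤D           _  _  ()

terminal-injective : ∀ {a b} → (if a then ⊤D else ⊥D) ≡ (if b then ⊤D else ⊥D) → a ≡ b
terminal-injective {true}  {true}  _  = refl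
terminal-injective {false} {false} _  = refl
terminal-injective {true}  {false} ()
terminal-injective {false} {true}  ()

zddFrom-children-injective : ∀ {m} j {G H : Vec Bool (suc m) → Bool} → zddFrom (suc m) j G ≡ zddFrom (suc m) j H →
                             ∀ b → zddFrom m (suc j) (G ∘ (b ∷_)) ≡ zddFrom m (suc j) (H ∘ (b ∷_))
zddFrom-children-injective {m} j {G} {H} eq b
  with lo≡lo′ , hi≡hi′ ← reduce-injective (zddFrom m (suc j) (G ∘ (true ∷_))) (zddFrom m (suc j) (H ∘ (true ∷_)))
                           (zddFrom-rootLabel≥ m (suc j) (G ∘ (false ∷_)))
                           (zddFrom-rootLabel≥ m (suc j) (H ∘ (false ∷_))) eq
  with b
... | false = lo≡lo′
... | true  = hi≡hi′

zddFrom-injective : ∀ m j {G H : Vec Bool m → Bool} → zddFrom m j G ≡ zddFrom m j H → ∀ w → G w ≡ H w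
zddFrom-injective zero    j {G} {H} eq []      = terminal-injective {G []} {H []} eq
zddFrom-injective (suc m) j {G} {H} eq (b ∷ w) =
  zddFrom-injective m (suc j) (zddFrom-children-injective {m} j {G} {H} eq b) w

zddFrom-empty : ∀ m j → zddFrom m j (λ _ → false) ≡ ⊥D
zddFrom-empty zero    j = refl
zddFrom-empty (suc m) j rewrite zddFrom-empty m (suc j) = refl

zddFrom-nonempty : ∀ m j {G : Vec Bool m → Bool} w → T (G w) → zddFrom m j G ≢ ⊥D
zddFrom-nonempty m j {G} w Gw eq =
  subst T (zddFrom-injective m j (trans eq (sym (zddFrom-empty m j))) w) Gw

node-⊆ˡ : ∀ i j lo hi → labeledNodes i lo ⊆ˡ labeledNodes i (node j lo hi)
node-⊆ˡ i j lo hi = ∈-++⁺ʳ (if j ≡ᵇ i then _ ∷ [] else []) ∘ ∈-++⁺ˡ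

node-⊆ʳ : ∀ i j lo hi → labeledNodes i hi ⊆ˡ labeledNodes i (node j lo hi)
node-⊆ʳ i j lo hi = ∈-++⁺ʳ (if j ≡ᵇ i then _ ∷ [] else []) ∘ ∈-++⁺ʳ (labeledNodes i lo)

node-∈-labeledNodes : ∀ j lo hi → node j lo hi ∈ˡ labeledNodes j (node j lo hi)
node-∈-labeledNodes j lo hi rewrite T-≡ .to (≡⇒≡ᵇ j j refl) = here refl

reduce-⊆ˡ : ∀ i j lo hi → labeledNodes i lo ⊆ˡ labeledNodes i (reduce j lo hi)
reduce-⊆ˡ i j lo ⊥D             = id
reduce-⊆ˡ i j lo ⊤D             = node-⊆ˡ i j lo ⊤D
reduce-⊆ˡ i j lo hi@(node _ _ _) = node-⊆ˡ i j lo hi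

reduce-⊆ʳ : ∀ i j lo hi → labeledNodes i hi ⊆ˡ labeledNodes i (reduce j lo hi)
reduce-⊆ʳ i j lo ⊥D             ()
reduce-⊆ʳ i j lo ⊤D             ()
reduce-⊆ʳ i j lo hi@(node _ _ _) = node-⊆ʳ i j lo hi

reduce-∈-labeledNodes : ∀ j lo hi → hi ≢ ⊥D → reduce j lo hi ∈ˡ labeledNodes j (reduce j lo hi)
reduce-∈-labeledNodes j lo ⊥D             hi≢⊥ = ⊥-elim (hi≢⊥ refl)
reduce-∈-labeledNodes j lo ⊤D             _    = node-∈-labeledNodes j lo ⊤D
reduce-∈-labeledNodes j lo hi@(node _ _ _) _    = node-∈-labeledNodes j lo hi

cofactor : ∀ {p m} → Vec Bool p → (Vec Bool (p + m) → Bool) → Vec Bool m → Bool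
cofactor v F w = F (v ++ w)

zddFrom-child-⊆ : ∀ i {m} j (F : Vec Bool (suc m) → Bool) b →
                  labeledNodes i (zddFrom m (suc j) (F ∘ (b ∷_))) ⊆ˡ labeledNodes i (zddFrom (suc m) j F)
zddFrom-child-⊆ i {m} j F false = reduce-⊆ˡ i j (zddFrom m (suc j) (F ∘ (false ∷_))) (zddFrom m (suc j) (F ∘ (true ∷_)))
zddFrom-child-⊆ i {m} j F true  = reduce-⊆ʳ i j (zddFrom m (suc j) (F ∘ (false ∷_))) (zddFrom m (suc j) (F ∘ (true ∷_)))

zddFrom-cofactor-⊆ : ∀ i {p m} j (F : Vec Bool (p + m) → Bool) (v : Vec Bool p) →
                     labeledNodes i (zddFrom m (j + p) (cofactor v F)) ⊆ˡ labeledNodes i (zddFrom (p + m) j F)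
zddFrom-cofactor-⊆ i         j F []      rewrite +-identityʳ j = id
zddFrom-cofactor-⊆ i {suc p} {m} j F (b ∷ v) rewrite +-suc j p =
  zddFrom-child-⊆ i {p + m} j F b ∘ zddFrom-cofactor-⊆ i (suc j) (F ∘ (b ∷_)) v

cofactor-∈-labeledNodes : ∀ {p m} (F : Vec Bool (p + suc m) → Bool) (v : Vec Bool p) w → T (F (v ++ true ∷ w)) →
                          zddFrom (suc m) p (cofactor v F) ∈ˡ labeledNodes p (ZDD (p + suc m) F)
cofactor-∈-labeledNodes {p} {m} F v w Fvw =
  zddFrom-cofactor-⊆ p 0 F v
    (reduce-∈-labeledNodes p _ _ (zddFrom-nonempty m (suc p) {cofactor v F ∘ (true ∷_)} w Fvw))

injection⇒≤length : ∀ {A : Set} {N} {xs : List A} (g : Fin N → A) → Injective _≡_ _≡_ g →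
                    (∀ a → g a ∈ˡ xs) → N ≤ length xs
injection⇒≤length {xs = xs} g g-injective g∈xs = injective⇒≤ λ {a} {b} same-index →
  g-injective (trans (lookup-index (g∈xs a)) (trans (cong (lookup xs) same-index) (sym (lookup-index (g∈xs b)))))

distinct-cofactors⇒≤width : ∀ {N p m} (F : Vec Bool (p + suc m) → Bool) (v : Fin N → Vec Bool p) →
          (∀ {a b} → (∀ w → cofactor (v a) F w ≡ cofactor (v b) F w) → a ≡ b) →
          (∀ a → ∃ λ w → T (F (v a ++ true ∷ w))) →
          N ≤ width p (ZDD (p + suc m) F)
distinct-cofactors⇒≤width {p = p} {m} F v cofactors-distinct cofactors-branch =
  injection⇒≤length (λ a → zddFrom (suc m) p (cofactor (v a) F))
    (cofactors-distinct ∘ zddFrom-injective (suc m) p)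
    (λ a → let (w , Fvw) = cofactors-branch a in ∈-deduplicate⁺ _≟D_ (cofactor-∈-labeledNodes F (v a) w Fvw))

allᵇ⁻ : ∀ {A : Set} (p : A → Bool) {xs x} → T (allᵇ p xs) → x ∈ˡ xs → T (p x)
allᵇ⁻ p {_ ∷ _} all (here refl) = proj₁ (T-∧ .to all)
allᵇ⁻ p {_ ∷ _} all (there x∈)  = allᵇ⁻ p (proj₂ (T-∧ .to all)) x∈

allᵇ⁺ : ∀ {A : Set} (p : A → Bool) {xs} → (∀ {x} → x ∈ˡ xs → T (p x)) → T (allᵇ p xs)
allᵇ⁺ p {[]}    _   = tt
allᵇ⁺ p {_ ∷ _} all = T-∧ .from (all (here refl) , allᵇ⁺ p (all ∘ there))

module _ {n} (M : LaminarMatroid n) where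

  independent⁻ : ∀ {I A c} → T (independent M I) → (A , c) ∈ˡ family M → ∣ I ∩ A ∣ ≤ c
  independent⁻ {I} indep A∈ = ≤ᵇ⇒≤ _ _ (allᵇ⁻ (λ (A , c) → ∣ I ∩ A ∣ ≤ᵇ c) indep A∈)

  independent⁺ : ∀ {I} → (∀ {A c} → (A , c) ∈ˡ family M → ∣ I ∩ A ∣ ≤ c) → T (independent M I)
  independent⁺ {I} capacities = allᵇ⁺ (λ (A , c) → ∣ I ∩ A ∣ ≤ᵇ c) (≤⇒≤ᵇ ∘ capacities)

  rank≤ : ∀ {r} → (∀ I → T (independent M I) → ∣ I ∣ ≤ r) → ∀ X → rank M X ≤ r
  rank≤ {r} bounded X = go (allSubsets n)
    where
    go : ∀ Is → foldr (λ I m → if independent M I ∧ (I ⊆ᵇ X) then ∣ I ∣ ⊔ m else m) 0 Is ≤ r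
    go []       = z≤n
    go (I ∷ Is) with independent M I in indep | I ⊆ᵇ X
    ... | true  | true  = ⊔-lub (bounded I (T-≡ .from indep)) (go Is)
    ... | true  | false = go Is
    ... | false | _     = go Is

  conn≤ : ∀ {r} → (∀ I → T (independent M I) → ∣ I ∣ ≤ r) → ∀ X → conn M X ≤ r + r
  conn≤ bounded X = ≤-trans (m∸n≤m _ (rank M ⊤)) (+-mono-≤ (rank≤ bounded X) (rank≤ bounded (∁ X)))

∣p++q∣≡∣p∣+∣q∣ : ∀ {m n} (p : Subset m) (q : Subset n) → ∣ p ++ q ∣ ≡ ∣ p ∣ + ∣ q ∣
∣p++q∣≡∣p∣+∣q∣ []          q = refl
∣p++q∣≡∣p∣+∣q∣ (true ∷ p)  q = cong suc (∣p++q∣≡∣p∣+∣q∣ p q)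
∣p++q∣≡∣p∣+∣q∣ (false ∷ p) q = ∣p++q∣≡∣p∣+∣q∣ p q

⊥++⊥≡⊥ : ∀ m {n} → ⊥ {m} ++ ⊥ {n} ≡ ⊥
⊥++⊥≡⊥ zero    = refl
⊥++⊥≡⊥ (suc m) = cong (false ∷_) (⊥++⊥≡⊥ m)

⁅x⁆∩⁅y⁆≡⊥ : ∀ {n} {x y : Fin n} → x ≢ y → ⁅ x ⁆ ∩ ⁅ y ⁆ ≡ ⊥
⁅x⁆∩⁅y⁆≡⊥ {x = x} {y} x≢y = Empty-unique λ (z , z∈x∩y) →
  let z∈x , z∈y = x∈p∩q⁻ ⁅ x ⁆ ⁅ y ⁆ z∈x∩y
  in x≢y (trans (sym (x∈⁅y⁆⇒x≡y x z∈x)) (x∈⁅y⁆⇒x≡y y z∈y))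

∣⁅x⁆∩p∣≤1 : ∀ {n} (x : Fin n) p → ∣ ⁅ x ⁆ ∩ p ∣ ≤ 1
∣⁅x⁆∩p∣≤1 x p = ≤-trans (∣p∩q∣≤∣p∣ ⁅ x ⁆ p) (≤-reflexive (∣⁅x⁆∣≡1 x))

∣⁅x⁆∩⁅y⁆∣≡0 : ∀ {n} {x y : Fin n} → x ≢ y → ∣ ⁅ x ⁆ ∩ ⁅ y ⁆ ∣ ≡ 0
∣⁅x⁆∩⁅y⁆∣≡0 {n} x≢y = trans (cong ∣_∣ (⁅x⁆∩⁅y⁆≡⊥ x≢y)) (∣⊥∣≡0 n)

module Twins (k : ℕ) where

  pairAcross : Fin k → Fin k → Subset (k + k)
  pairAcross a b = ⁅ a ⁆ ++ ⁅ b ⁆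

  twins : Fin k → Subset (k + k)
  twins l = pairAcross l l

  ∣pairAcross∩pairAcross∣ : ∀ a b c d → ∣ pairAcross a b ∩ pairAcross c d ∣ ≡ ∣ ⁅ a ⁆ ∩ ⁅ c ⁆ ∣ + ∣ ⁅ b ⁆ ∩ ⁅ d ⁆ ∣
  ∣pairAcross∩pairAcross∣ a b c d =
    trans (cong ∣_∣ (zipWith-++ _∧_ ⁅ a ⁆ ⁅ b ⁆ ⁅ c ⁆ ⁅ d ⁆)) (∣p++q∣≡∣p∣+∣q∣ (⁅ a ⁆ ∩ ⁅ c ⁆) (⁅ b ⁆ ∩ ⁅ d ⁆))

  twins-disjoint : ∀ {l l′} → l ≢ l′ → twins l ∩ twins l′ ≡ ⊥
  twins-disjoint {l} {l′} l≢l′ = begin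
    twins l ∩ twins l′                          ≡⟨ zipWith-++ _∧_ ⁅ l ⁆ ⁅ l ⁆ ⁅ l′ ⁆ ⁅ l′ ⁆ ⟩
    (⁅ l ⁆ ∩ ⁅ l′ ⁆) ++ (⁅ l ⁆ ∩ ⁅ l′ ⁆)        ≡⟨ cong₂ _++_ (⁅x⁆∩⁅y⁆≡⊥ l≢l′) (⁅x⁆∩⁅y⁆≡⊥ l≢l′) ⟩
    ⊥ {k} ++ ⊥ {k}                              ≡⟨ ⊥++⊥≡⊥ k ⟩
    ⊥                                           ∎
    where open ≡-Reasoning

  twinFamily : List (Subset (k + k) × ℕ)
  twinFamily = (⊤ , 2) ∷ map (λ l → twins l , 1) (allFin k)

  twinFamily-members : ∀ {A c} → (A , c) ∈ˡ twinFamily → (A ≡ ⊤ × c ≡ 2) ⊎ ∃ λ l → A ≡ twins l × c ≡ 1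
  twinFamily-members (here refl) = inj₁ (refl , refl)
  twinFamily-members (there A∈) with ∈-map⁻ _ A∈
  ... | l , _ , refl = inj₂ (l , refl , refl)

  twinFamily-sets : ∀ {A} → A ∈ˡ map proj₁ twinFamily → A ≡ ⊤ ⊎ ∃ λ l → A ≡ twins l
  twinFamily-sets A∈ with ∈-map⁻ proj₁ A∈
  ... | _ , Ac∈ , refl with twinFamily-members Ac∈
  ...   | inj₁ (A≡⊤ , _)       = inj₁ A≡⊤
  ...   | inj₂ (l , A≡twins , _) = inj₂ (l , A≡twins)

  twinFamily-laminar : ∀ {A B} → A ∈ˡ map proj₁ twinFamily → B ∈ˡ map proj₁ twinFamily →
                       Nonempty (A ∩ B) → A ⊆ B ⊎ B ⊆ A
  twinFamily-laminar A∈ B∈ A∩B≢∅ with twinFamily-sets A∈ | twinFamily-sets B∈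
  ... | inj₁ refl         | _                 = inj₂ ⊆⊤
  ... | inj₂ _            | inj₁ refl         = inj₁ ⊆⊤
  ... | inj₂ (l , refl)   | inj₂ (l′ , refl)  with l ≟ᶠ l′
  ...   | yes refl = inj₁ ⊆-refl
  ...   | no l≢l′  = let x , x∈ = A∩B≢∅ in ⊥-elim (∉⊥ (subst (x ∈_) (twins-disjoint l≢l′) x∈))

  twinMatroid : LaminarMatroid (k + k)
  twinMatroid = record { family = twinFamily ; laminar = twinFamily-laminar }

  independent⇒∣I∣≤2 : ∀ I → T (independent twinMatroid I) → ∣ I ∣ ≤ 2
  independent⇒∣I∣≤2 I indep = subst (_≤ 2) (cong ∣_∣ (∩-identityʳ I)) (independent⁻ twinMatroid {I} indep (here refl))

  pairAcross-independent : ∀ a b → a ≢ b → T (independent twinMatroid (pairAcross a b))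
  pairAcross-independent a b a≢b =
    independent⁺ twinMatroid {pairAcross a b} (capacity-respected ∘ twinFamily-members)
    where
    capacity-respected : ∀ {A c} → (A ≡ ⊤ × c ≡ 2) ⊎ ∃ (λ l → A ≡ twins l × c ≡ 1) → ∣ pairAcross a b ∩ A ∣ ≤ c
    capacity-respected (inj₁ (refl , refl)) rewrite ∩-identityʳ (pairAcross a b) | ∣p++q∣≡∣p∣+∣q∣ ⁅ a ⁆ ⁅ b ⁆
                                      | ∣⁅x⁆∣≡1 a | ∣⁅x⁆∣≡1 b = ≤-refl
    capacity-respected (inj₂ (l , refl , refl)) rewrite ∣pairAcross∩pairAcross∣ a b l l with a ≟ᶠ l
    ... | yes refl rewrite ∣⁅x⁆∩⁅y⁆∣≡0 {k} (a≢b ∘ sym) | +-identityʳ ∣ ⁅ a ⁆ ∩ ⁅ a ⁆ ∣ = ∣⁅x⁆∩p∣≤1 a ⁅ a ⁆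
    ... | no a≢l   rewrite ∣⁅x⁆∩⁅y⁆∣≡0 {k} a≢l = ∣⁅x⁆∩p∣≤1 b ⁅ l ⁆

  twins-dependent : ∀ l → ¬ T (independent twinMatroid (twins l))
  twins-dependent l indep = 1+n≰n (begin
    2                                ≡⟨ sym (cong₂ _+_ (∣⁅x⁆∣≡1 l) (∣⁅x⁆∣≡1 l)) ⟩
    ∣ ⁅ l ⁆ ∣ + ∣ ⁅ l ⁆ ∣            ≡⟨ sym (∣p++q∣≡∣p∣+∣q∣ ⁅ l ⁆ ⁅ l ⁆) ⟩
    ∣ twins l ∣                      ≡⟨ cong ∣_∣ (sym (∩-idem (twins l))) ⟩
    ∣ twins l ∩ twins l ∣            ≤⟨ independent⁻ twinMatroid {twins l} indep twins∈twinFamily ⟩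
    1                                ∎)
    where
    open ≤-Reasoning
    twins∈twinFamily : (twins l , 1) ∈ˡ twinFamily
    twins∈twinFamily = there (∈-map⁺ (λ l → twins l , 1) (∈-allFin l))

  twinMatroid-conn≤4 : ∀ X → conn twinMatroid X ≤ 4
  twinMatroid-conn≤4 = conn≤ twinMatroid independent⇒∣I∣≤2

twinMatroid-width : ∀ m → m ≤ width (suc m) (ZDD-indep (Twins.twinMatroid (suc m)))
twinMatroid-width m =
  distinct-cofactors⇒≤width (independent twinMatroid) (λ a → ⁅ suc a ⁆) distinct (λ a → ⊥ , branches a)
  where
  open Twins (suc m)
  branches : ∀ a → T (independent twinMatroid (pairAcross (suc a) zero))
  branches a = pairAcross-independent (suc a) zero (λ ())
  distinct : ∀ {a b} → (∀ w → cofactor ⁅ suc a ⁆ (independent twinMatroid) w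
                             ≡ cofactor ⁅ suc b ⁆ (independent twinMatroid) w) → a ≡ b
  distinct {a} {b} same-cofactor with a ≟ᶠ b
  ... | yes a≡b = a≡b
  ... | no  a≢b = ⊥-elim (twins-dependent (suc a)
                    (subst T (sym (same-cofactor ⁅ suc a ⁆))
                      (pairAcross-independent (suc b) (suc a) (a≢b ∘ sym ∘ suc-injective))))

maxUpTo : (ℕ → ℕ) → ℕ → ℕ
maxUpTo f zero    = f zero
maxUpTo f (suc c) = maxUpTo f c ⊔ f (suc c)

≤-maxUpTo : ∀ f {v c} → v ≤ c → f v ≤ maxUpTo f c
≤-maxUpTo f = go ∘ ≤⇒≤′
  where
  go : ∀ {v c} → v ≤′ c → f v ≤ maxUpTo f c
  go {zero}  ≤′-refl       = ≤-refl
  go {suc v} ≤′-refl       = m≤n⊔m (maxUpTo f v) (f (suc v))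
  go         (≤′-step v≤c) = m≤n⇒m≤n⊔o _ (go v≤c)

theorem4p10 : ¬ (Σ (ℕ → ℕ) λ f →
                  (n : ℕ) (M : LaminarMatroid n) (i : Fin n) →
                  width (toℕ i) (ZDD-indep M) ≤ f (conn M (prefix (toℕ i))))
theorem4p10 (f , width≤f) = 1+n≰n (begin-strict
  B                                 <⟨ twinMatroid-width (suc B) ⟩
  width k (ZDD-indep twinMatroid)    ≤⟨ width≤f-at k (m<m+n k z<s) ⟩
  f (conn twinMatroid (prefix k))    ≤⟨ ≤-maxUpTo f (twinMatroid-conn≤4 (prefix k)) ⟩
  B                                 ∎)
  where
  B k : ℕ
  B = maxUpTo f 4
  k = suc (suc B)
  open Twins k
  open ≤-Reasoning
  width≤f-at : ∀ i → i < k + k → width i (ZDD-indep twinMatroid) ≤ f (conn twinMatroid (prefix i))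
  width≤f-at i i<k+k = subst (λ t → width t (ZDD-indep twinMatroid) ≤ f (conn twinMatroid (prefix t)))
                           (toℕ-fromℕ< i<k+k) (width≤f (k + k) twinMatroid (fromℕ< i<k+k))
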